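{- Let $C$ be an $(X,2)$-neighbour-transitive code with $T_C\le X$ and minimum distance $\delta\ge5$ in the Hamming graph $H(m,2)$ with vertex set $V\cong\mathbb{F}_2^m$. Then $X^M\cong X_{\mathbf 0}$ acts $2$-homogeneously on $M$, and $C$ is a submodule of $V$, regarded as the $\mathbb{F}_2$-permutation module for the action of $X_{\mathbf 0}$ on $M$.
   Context: $H(m,2)$ has vertex set $V=\mathbb{F}_2^M$ ($M$ a set of $m$ entries), adjacency meaning difference in exactly one entry. $\mathrm{Aut}(H(m,2))=B\rtimes L$, $B=\mathrm{Sym}(\mathbb{F}_2)^m$ acting entrywise and $L=\mathrm{Sym}(M)$ permuting entries; $\mathrm{Aut}(C)$ is the setwise stabiliser of the code $C\subseteq V$; $C_s$ is the set of vertices at distance exactly $s$ from the nearest codeword. $X\le\mathrm{Aut}(C)$; $C$ is $(X,2)$-neighbour-transitive if $X$ is transitive on $C$, $C_1$, $C_2$. $T_C$ is the set of translations $\beta\mapsto\beta+\alpha$ for $\alpha\in C$. $X^M$ is the permutation group induced by $X$ on $M$; $X_{\mathbf 0}$ is the stabiliser of the zero vertex. -}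

module Defs where

open import Data.Nat using (ℕ; zero; suc; _≤_)
open import Data.Bool using (Bool; true; false; _xor_)
open import Data.Fin using (Fin)
open import Data.Vec using (Vec; []; _∷_; lookup; tabulate; replicate; zipWith)
open import Data.Fin.Permutation using (Permutation′; _⟨$⟩ʳ_; _⟨$⟩ˡ_; _∘ₚ_; flip)
import Data.Fin.Permutation as P
open import Data.Product using (Σ; ∃; _×_; _,_)
open import Data.Sum using (_⊎_)
open import Relation.Binary.PropositionalEquality using (_≡_; _≢_)
open import Function.Bundles using (_⇔_)

-- Vertices of H(m,2): V = F₂^M with M = Fin m, F₂ = Bool (xor is addition).
V : ℕ → Set
V m = Vec Bool m

𝟎 : ∀ {m} → V m
𝟎 = replicate _ false

_⊕_ : ∀ {m} → V m → V m → V m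
_⊕_ = zipWith _xor_

dist : ∀ {m} → V m → V m → ℕ
dist []       []       = 0
dist (x ∷ u) (y ∷ v) with x xor y
... | true  = suc (dist u v)
... | false = dist u v

-- Entry permutation action of L = Sym(M) on V:  (σ·v)_{σ i} = v_i.
permute : ∀ {m} → Permutation′ m → V m → V m
permute σ v = tabulate (λ j → lookup v (σ ⟨$⟩ˡ j))

-- Elements of Aut(H(m,2)) = B ⋊ L.  Since Sym(F₂) ≅ F₂ acts by
-- translation, B ≅ F₂^m and an element is a pair (shift b, entry permutation σ),
-- acting as  v ↦ σ·v + b.
record Aut (m : ℕ) : Set where
  constructor aut
  field
    shift : V m
    perm  : Permutation′ m
open Aut public

act : ∀ {m} → Aut m → V m → V m
act g v = permute (perm g) v ⊕ shift g

_≈A_ : ∀ {m} → Aut m → Aut m → Set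
g ≈A h = (shift g ≡ shift h) × (perm g P.≈ perm h)

idA : ∀ {m} → Aut m
idA = aut 𝟎 P.id

-- act (g ·A h) v = act h (act g v)
_·A_ : ∀ {m} → Aut m → Aut m → Aut m
g ·A h = aut (act h (shift g)) (perm g ∘ₚ perm h)

invA : ∀ {m} → Aut m → Aut m
invA g = aut (permute (flip (perm g)) (shift g)) (flip (perm g))

translation : ∀ {m} → V m → Aut m
translation α = aut α P.id

record IsSubgroup {m : ℕ} (X : Aut m → Set) : Set where
  field
    respects : ∀ {g h} → g ≈A h → X g → X h
    has-id   : X idA
    closed-· : ∀ {g h} → X g → X h → X (g ·A h)
    closed-⁻¹ : ∀ {g} → X g → X (invA g)

StabilisesCode : ∀ {m} → (Aut m → Set) → (V m → Set) → Set
StabilisesCode {m} X C = ∀ g → X g → ∀ (v : V m) → C v ⇔ C (act g v)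

Cs : ∀ {m} → (V m → Set) → ℕ → V m → Set
Cs {m} C s v = (∃ λ c → C c × dist v c ≡ s) × (∀ c → C c → s ≤ dist v c)

TransitiveOn : ∀ {m} → (Aut m → Set) → (V m → Set) → Set
TransitiveOn X S = ∀ u v → S u → S v → ∃ λ g → X g × act g u ≡ v

NeighbourTransitive2 : ∀ {m} → (Aut m → Set) → (V m → Set) → Set
NeighbourTransitive2 X C =
  TransitiveOn X C × TransitiveOn X (Cs C 1) × TransitiveOn X (Cs C 2)

TranslationsIn : ∀ {m} → (Aut m → Set) → (V m → Set) → Set
TranslationsIn X C = ∀ α → C α → X (translation α)

MinDistAtLeast : ∀ {m} → ℕ → (V m → Set) → Set
MinDistAtLeast d C = ∀ u v → C u → C v → u ≢ v → d ≤ dist u v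

Stab0 : ∀ {m} → (Aut m → Set) → Aut m → Set
Stab0 X g = X g × act g 𝟎 ≡ 𝟎

InducedOnM : ∀ {m} → (Aut m → Set) → Permutation′ m → Set
InducedOnM X σ = ∃ λ g → X g × perm g P.≈ σ

-- The natural map X_0 → X^M, g ↦ perm g, is a bijection (group isomorphism;
-- it is a homomorphism by definition of ·A).
X0≅XM : ∀ {m} → (Aut m → Set) → Set
X0≅XM X =
  (∀ σ → InducedOnM X σ → ∃ λ g → Stab0 X g × perm g P.≈ σ)
  × (∀ g h → Stab0 X g → Stab0 X h → perm g P.≈ perm h → g ≈A h)

TwoHomogeneous : ∀ {m} → (Permutation′ m → Set) → Set
TwoHomogeneous {m} G =
  ∀ (i j k l : Fin m) → i ≢ j → k ≢ l →
    ∃ λ σ → G σ × (((σ ⟨$⟩ʳ i ≡ k) × (σ ⟨$⟩ʳ j ≡ l)) ⊎ ((σ ⟨$⟩ʳ i ≡ l) × (σ ⟨$⟩ʳ j ≡ k)))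

IsSubmodule : ∀ {m} → (Aut m → Set) → (V m → Set) → Set
IsSubmodule X C =
  C 𝟎
  × (∀ u v → C u → C v → C (u ⊕ v))
  × (∀ g v → Stab0 X g → C v → C (permute (perm g) v))

module Submission where

-- Translations by codewords lie in X, so C contains 0 and is closed under
-- addition, and an element of X fixing 0 has trivial shift, i.e. is a bare
-- coordinate permutation; hence X₀ preserves C, and X₀ → X^M is onto because
-- any g ∈ X composed with the translation by g(0) ∈ C fixes 0.  Since δ ≥ 5,
-- every weight-2 vector lies in C₂.  If g ∈ X carries the weight-2 vector on
-- {i,j} to the one on {k,l}, then the codeword g(0) is within distance 2 + 2
-- of 0, so g fixes 0 and its coordinate permutation maps {i,j} onto {k,l}.

open import Defs
open import Data.Nat using (ℕ; zero; suc; _+_; _≤_; _<_; z≤n; s≤s)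
open import Data.Nat.Properties
  using (+-0-commutativeMonoid; +-mono-≤; +-cancelˡ-≤; ≤-reflexive; n≤1+n; <⇒≱)
open import Data.Product using (∃; _×_; _,_)
open import Data.Sum using (_⊎_; inj₁; inj₂)
open import Data.Bool using (Bool; true; false; _xor_)
open import Data.Bool.Properties
  using (xor-assoc; xor-comm; xor-same; xor-identityˡ; xor-identityʳ) renaming (_≟_ to _≟ᴮ_)
open import Data.Fin using (Fin; zero; suc)
import Data.Fin.Properties as Fin
open import Data.Vec using ([]; _∷_; lookup; tabulate; replicate; _[_]≔_)
open import Data.Vec.Functional using (Vector)
open import Data.Vec.Properties
  using (lookup∘tabulate; tabulate∘lookup; tabulate-cong; lookup-replicate; lookup-zipWith;
         lookup∘update; lookup∘update′; zipWith-identityˡ; zipWith-identityʳ; zipWith-inverseˡ;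
         map-id; ≡-dec)
open import Data.Fin.Permutation using (Permutation′; _⟨$⟩ʳ_; _⟨$⟩ˡ_; inverseˡ)
import Data.Fin.Permutation as P
open import Function using (_∘_; Injection)
open import Function.Bundles using (Equivalence)
open import Function.Properties.Inverse using (↔⇒↣)
open import Relation.Binary.PropositionalEquality
open import Relation.Nullary using (Dec; yes; no; contradiction)
open import Algebra.Properties.CommutativeMonoid.Sum +-0-commutativeMonoid
  using (sum; sum-cong-≗; sum-permute; ∑-distrib-+)

private
  variable
    m s d : ℕ
    u v : V m
    i j k l p : Fin m

⊕-identityˡ : (v : V m) → 𝟎 ⊕ v ≡ v
⊕-identityˡ = zipWith-identityˡ xor-identityˡ

⊕-identityʳ : (v : V m) → v ⊕ 𝟎 ≡ v
⊕-identityʳ = zipWith-identityʳ xor-identityʳ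

⊕-same : (v : V m) → v ⊕ v ≡ 𝟎
⊕-same v = trans (cong (_⊕ v) (sym (map-id v))) (zipWith-inverseˡ xor-same v)

_≟V_ : (u v : V m) → Dec (u ≡ v)
_≟V_ = ≡-dec _≟ᴮ_

permute-𝟎 : (σ : Permutation′ m) → permute σ 𝟎 ≡ 𝟎
permute-𝟎 σ = begin
  tabulate (λ j → lookup 𝟎 (σ ⟨$⟩ˡ j)) ≡⟨ tabulate-cong constant ⟩
  tabulate (lookup 𝟎)                  ≡⟨ tabulate∘lookup 𝟎 ⟩
  𝟎                                    ∎
  where
  open ≡-Reasoning
  constant : ∀ j → lookup 𝟎 (σ ⟨$⟩ˡ j) ≡ lookup 𝟎 j
  constant j = trans (lookup-replicate (σ ⟨$⟩ˡ j) false) (sym (lookup-replicate j false))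

permute-id : (v : V m) → permute P.id v ≡ v
permute-id = tabulate∘lookup

lookup-permute : (σ : Permutation′ m) (v : V m) (i : Fin m) →
                 lookup (permute σ v) (σ ⟨$⟩ʳ i) ≡ lookup v i
lookup-permute σ v i =
  trans (lookup∘tabulate _ (σ ⟨$⟩ʳ i)) (cong (lookup v) (inverseˡ σ))

act-𝟎 : (g : Aut m) → act g 𝟎 ≡ shift g
act-𝟎 g = trans (cong (_⊕ shift g) (permute-𝟎 (perm g))) (⊕-identityˡ (shift g))

act-translation : (α v : V m) → act (translation α) v ≡ v ⊕ α
act-translation α v = cong (_⊕ α) (permute-id v)

act≡permute : (g : Aut m) → act g 𝟎 ≡ 𝟎 → (v : V m) → act g v ≡ permute (perm g) v
act≡permute g g𝟎≡𝟎 v =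
  trans (cong (permute (perm g) v ⊕_) (trans (sym (act-𝟎 g)) g𝟎≡𝟎)) (⊕-identityʳ _)

indicator : Bool → ℕ
indicator true  = 1
indicator false = 0

indicator-xor-≤ : ∀ x y → indicator (x xor y) ≤ indicator x + indicator y
indicator-xor-≤ false y     = ≤-reflexive refl
indicator-xor-≤ true  false = s≤s z≤n
indicator-xor-≤ true  true  = z≤n

xor-telescope : ∀ x y z → (x xor y) xor (y xor z) ≡ x xor z
xor-telescope x y z = begin
  (x xor y) xor (y xor z) ≡⟨ xor-assoc x y (y xor z) ⟩
  x xor (y xor (y xor z)) ≡⟨ cong (x xor_) (xor-assoc y y z) ⟨
  x xor ((y xor y) xor z) ≡⟨ cong (λ b → x xor (b xor z)) (xor-same y) ⟩
  x xor z                 ∎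
  where open ≡-Reasoning

sum-mono-≤ : ∀ {n} {f g : Vector ℕ n} → (∀ i → f i ≤ g i) → sum f ≤ sum g
sum-mono-≤ {zero}  _   = z≤n
sum-mono-≤ {suc n} f≤g = +-mono-≤ (f≤g zero) (sum-mono-≤ (f≤g ∘ suc))

differ : V m → V m → Vector ℕ m
differ u v p = indicator (lookup u p xor lookup v p)

dist≡sum : (u v : V m) → dist u v ≡ sum (differ u v)
dist≡sum []      []      = refl
dist≡sum (x ∷ u) (y ∷ v) with x xor y
... | true  = cong suc (dist≡sum u v)
... | false = dist≡sum u v

dist-sym : (u v : V m) → dist u v ≡ dist v u
dist-sym u v = begin
  dist u v         ≡⟨ dist≡sum u v ⟩
  sum (differ u v) ≡⟨ sum-cong-≗ (λ p → cong indicator (xor-comm (lookup u p) (lookup v p))) ⟩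
  sum (differ v u) ≡⟨ dist≡sum v u ⟨
  dist v u         ∎
  where open ≡-Reasoning

dist-triangle : (u v w : V m) → dist u w ≤ dist u v + dist v w
dist-triangle u v w = begin
  dist u w                                ≡⟨ dist≡sum u w ⟩
  sum (differ u w)                        ≤⟨ sum-mono-≤ pointwise ⟩
  sum (λ p → differ u v p + differ v w p) ≡⟨ ∑-distrib-+ (differ u v) (differ v w) ⟩
  sum (differ u v) + sum (differ v w)     ≡⟨ cong₂ _+_ (dist≡sum u v) (dist≡sum v w) ⟨
  dist u v + dist v w                     ∎
  where
  open Data.Nat.Properties.≤-Reasoning
  pointwise : ∀ p → differ u w p ≤ differ u v p + differ v w p
  pointwise p = subst (λ b → indicator b ≤ differ u v p + differ v w p)
                      (xor-telescope (lookup u p) (lookup v p) (lookup w p))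
                      (indicator-xor-≤ (lookup u p xor lookup v p) (lookup v p xor lookup w p))

dist-⊕ʳ : (b u v : V m) → dist (u ⊕ b) (v ⊕ b) ≡ dist u v
dist-⊕ʳ b u v = begin
  dist (u ⊕ b) (v ⊕ b)         ≡⟨ dist≡sum (u ⊕ b) (v ⊕ b) ⟩
  sum (differ (u ⊕ b) (v ⊕ b)) ≡⟨ sum-cong-≗ (cong indicator ∘ cancel) ⟩
  sum (differ u v)             ≡⟨ dist≡sum u v ⟨
  dist u v                     ∎
  where
  open ≡-Reasoning
  cancel : ∀ p → lookup (u ⊕ b) p xor lookup (v ⊕ b) p ≡ lookup u p xor lookup v p
  cancel p = begin
    lookup (u ⊕ b) p xor lookup (v ⊕ b) p
      ≡⟨ cong₂ _xor_ (lookup-zipWith _xor_ p u b) (lookup-zipWith _xor_ p v b) ⟩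
    (lookup u p xor lookup b p) xor (lookup v p xor lookup b p)
      ≡⟨ cong ((lookup u p xor lookup b p) xor_) (xor-comm (lookup v p) (lookup b p)) ⟩
    (lookup u p xor lookup b p) xor (lookup b p xor lookup v p)
      ≡⟨ xor-telescope (lookup u p) (lookup b p) (lookup v p) ⟩
    lookup u p xor lookup v p ∎

dist-permute : (σ : Permutation′ m) (u v : V m) → dist (permute σ u) (permute σ v) ≡ dist u v
dist-permute σ u v = begin
  dist (permute σ u) (permute σ v)                      ≡⟨ dist≡sum (permute σ u) (permute σ v) ⟩
  sum (differ (permute σ u) (permute σ v))              ≡⟨ sum-permute _ σ ⟩
  sum (differ (permute σ u) (permute σ v) ∘ (σ ⟨$⟩ʳ_)) ≡⟨ sum-cong-≗ permuted ⟩
  sum (differ u v)                                      ≡⟨ dist≡sum u v ⟨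
  dist u v                                              ∎
  where
  open ≡-Reasoning
  permuted : ∀ p → differ (permute σ u) (permute σ v) (σ ⟨$⟩ʳ p) ≡ differ u v p
  permuted p = cong₂ (λ x y → indicator (x xor y)) (lookup-permute σ u p) (lookup-permute σ v p)

dist-act : (g : Aut m) (u v : V m) → dist (act g u) (act g v) ≡ dist u v
dist-act g u v =
  trans (dist-⊕ʳ (shift g) (permute (perm g) u) (permute (perm g) v)) (dist-permute (perm g) u v)

unit : Fin m → V m
unit i = 𝟎 [ i ]≔ true

pair : Fin m → Fin m → V m
pair i j = unit i ⊕ unit j

dist-refl : (v : V m) → dist v v ≡ 0
dist-refl []          = refl
dist-refl (false ∷ v) = dist-refl v
dist-refl (true ∷ v)  = dist-refl v

dist-unit-𝟎 : (i : Fin m) → dist (unit i) 𝟎 ≡ 1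
dist-unit-𝟎 {suc m} zero = cong suc (dist-refl (𝟎 {m}))
dist-unit-𝟎 (suc i)      = dist-unit-𝟎 i

dist-pair-𝟎 : (i j : Fin m) → i ≢ j → dist (pair i j) 𝟎 ≡ 2
dist-pair-𝟎 zero    zero    i≢j = contradiction refl i≢j
dist-pair-𝟎 zero    (suc j) _   = cong suc (trans (cong (λ w → dist w 𝟎) (⊕-identityˡ (unit j)))
                                                      (dist-unit-𝟎 j))
dist-pair-𝟎 (suc i) zero    _   = cong suc (trans (cong (λ w → dist w 𝟎) (⊕-identityʳ (unit i)))
                                                      (dist-unit-𝟎 i))
dist-pair-𝟎 (suc i) (suc j) i≢j = dist-pair-𝟎 i j (i≢j ∘ cong suc)

lookup-pair : (i j p : Fin m) → lookup (pair i j) p ≡ lookup (unit i) p xor lookup (unit j) p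
lookup-pair i j p = lookup-zipWith _xor_ p (unit i) (unit j)

lookup-unit : (i : Fin m) → lookup (unit i) i ≡ true
lookup-unit i = lookup∘update i 𝟎 true

lookup-unit-≢ : (i : Fin m) → i ≢ p → lookup (unit i) p ≡ false
lookup-unit-≢ {p = p} i i≢p = trans (lookup∘update′ (i≢p ∘ sym) 𝟎 true) (lookup-replicate p false)

lookup-pairˡ : i ≢ j → lookup (pair i j) i ≡ true
lookup-pairˡ {i = i} {j} i≢j =
  trans (lookup-pair i j i) (cong₂ _xor_ (lookup-unit i) (lookup-unit-≢ j (i≢j ∘ sym)))

lookup-pairʳ : i ≢ j → lookup (pair i j) j ≡ true
lookup-pairʳ {i = i} {j} i≢j =
  trans (lookup-pair i j j) (cong₂ _xor_ (lookup-unit-≢ i i≢j) (lookup-unit j))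

pair-support : (i j : Fin m) → lookup (pair i j) p ≡ true → p ≡ i ⊎ p ≡ j
pair-support {p = p} i j pᵢⱼ with i Fin.≟ p | j Fin.≟ p
... | yes refl | _        = inj₁ refl
... | no _     | yes refl = inj₂ refl
... | no i≢p   | no j≢p   = contradiction
  (trans (sym pᵢⱼ) (trans (lookup-pair i j p)
                           (cong₂ _xor_ (lookup-unit-≢ i i≢p) (lookup-unit-≢ j j≢p))))
  λ ()

permute-pair : (σ : Permutation′ m) → i ≢ j → permute σ (pair i j) ≡ pair k l →
  ((σ ⟨$⟩ʳ i ≡ k) × (σ ⟨$⟩ʳ j ≡ l)) ⊎ ((σ ⟨$⟩ʳ i ≡ l) × (σ ⟨$⟩ʳ j ≡ k))
permute-pair {i = i} {j} {k} {l} σ i≢j σij≡kl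
  with pair-support k l (image i (lookup-pairˡ i≢j)) | pair-support k l (image j (lookup-pairʳ i≢j))
  where
  image : ∀ p → lookup (pair i j) p ≡ true → lookup (pair k l) (σ ⟨$⟩ʳ p) ≡ true
  image p pᵢⱼ = trans (cong (λ w → lookup w (σ ⟨$⟩ʳ p)) (sym σij≡kl))
                      (trans (lookup-permute σ (pair i j) p) pᵢⱼ)
... | inj₁ σi≡k | inj₂ σj≡l = inj₁ (σi≡k , σj≡l)
... | inj₂ σi≡l | inj₁ σj≡k = inj₂ (σi≡l , σj≡k)
... | inj₁ σi≡k | inj₁ σj≡k = contradiction (injective (trans σi≡k (sym σj≡k))) i≢j
  where open Injection (↔⇒↣ σ) using (injective)
... | inj₂ σi≡l | inj₂ σj≡l = contradiction (injective (trans σi≡l (sym σj≡l))) i≢j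
  where open Injection (↔⇒↣ σ) using (injective)

module _ {C : V m → Set} where

  codewords-equal-if-close : MinDistAtLeast d C → C u → C v → dist u v < d → u ≡ v
  codewords-equal-if-close {u = u} {v} δ Cu Cv u~v with u ≟V v
  ... | yes u≡v = u≡v
  ... | no  u≢v = contradiction (δ u v Cu Cv u≢v) (<⇒≱ u~v)

  weight-in-Cs : MinDistAtLeast (suc (s + s)) C → C 𝟎 → (v : V m) → dist v 𝟎 ≡ s → Cs C s v
  weight-in-Cs {s = s} δ C𝟎 v |v|≡s = (𝟎 , C𝟎 , |v|≡s) , nearest
    where
    nearest : ∀ c → C c → s ≤ dist v c
    nearest c Cc with c ≟V 𝟎
    ... | yes refl = ≤-reflexive (sym |v|≡s)
    ... | no  c≢𝟎  = +-cancelˡ-≤ s s (dist v c) (begin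
      s + s               ≤⟨ n≤1+n (s + s) ⟩
      suc (s + s)         ≤⟨ δ 𝟎 c C𝟎 Cc (c≢𝟎 ∘ sym) ⟩
      dist 𝟎 c            ≤⟨ dist-triangle 𝟎 v c ⟩
      dist 𝟎 v + dist v c ≡⟨ cong (_+ dist v c) (trans (dist-sym 𝟎 v) |v|≡s) ⟩
      s + dist v c        ∎)
      where open Data.Nat.Properties.≤-Reasoning

  module _ {X : Aut m → Set} (stabilises : StabilisesCode X C) where

    act-preserves : ∀ {g} → X g → C v → C (act g v)
    act-preserves {v = v} {g} Xg = Equivalence.to (stabilises g Xg v)

    fixes-𝟎 : MinDistAtLeast (suc (s + s)) C → C 𝟎 → ∀ {g} → X g → (v : V m) →
              dist v 𝟎 ≡ s → dist (act g v) 𝟎 ≡ s → act g 𝟎 ≡ 𝟎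
    fixes-𝟎 {s = s} δ C𝟎 {g} Xg v |v|≡s |gv|≡s =
      codewords-equal-if-close δ (act-preserves Xg C𝟎) C𝟎 (s≤s (begin
        dist (act g 𝟎) 𝟎                            ≤⟨ dist-triangle (act g 𝟎) (act g v) 𝟎 ⟩
        dist (act g 𝟎) (act g v) + dist (act g v) 𝟎 ≡⟨ cong₂ _+_ g𝟎~gv |gv|≡s ⟩
        s + s                                       ∎))
      where
      open Data.Nat.Properties.≤-Reasoning
      g𝟎~gv : dist (act g 𝟎) (act g v) ≡ s
      g𝟎~gv = trans (dist-act g 𝟎 v) (trans (dist-sym 𝟎 v) |v|≡s)

    module _ (translations : TranslationsIn X C) where

      𝟎∈C : ∃ C → C 𝟎
      𝟎∈C (c , Cc) = subst C (trans (act-translation c c) (⊕-same c))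
                             (act-preserves (translations c Cc) Cc)

      ⊕-closed : C u → C v → C (u ⊕ v)
      ⊕-closed {u = u} {v = v} Cu Cv =
        subst C (act-translation v u) (act-preserves (translations v Cv) Cu)

      isSubmodule : ∃ C → IsSubmodule X C
      isSubmodule nonempty = 𝟎∈C nonempty , (λ _ _ → ⊕-closed) , permute-closed
        where
        permute-closed : ∀ g v → Stab0 X g → C v → C (permute (perm g) v)
        permute-closed g v (Xg , g𝟎≡𝟎) Cv = subst C (act≡permute g g𝟎≡𝟎 v) (act-preserves Xg Cv)

      X₀≅X^M : IsSubgroup X → C 𝟎 → X0≅XM X
      X₀≅X^M subgroup C𝟎 = onto , one-to-one
        where
        open IsSubgroup subgroup using (closed-·)
        onto : ∀ σ → InducedOnM X σ → ∃ λ g → Stab0 X g × perm g P.≈ σ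
        onto σ (g , Xg , g≈σ) = g ·A translation (shift g) , (X[g·t] , fixed) , g≈σ
          where
          X[g·t] : X (g ·A translation (shift g))
          X[g·t] = closed-· Xg (translations (shift g) (subst C (act-𝟎 g) (act-preserves Xg C𝟎)))
          fixed : act (g ·A translation (shift g)) 𝟎 ≡ 𝟎
          fixed = trans (act-𝟎 (g ·A translation (shift g)))
                        (trans (act-translation (shift g) (shift g)) (⊕-same (shift g)))

        one-to-one : ∀ g h → Stab0 X g → Stab0 X h → perm g P.≈ perm h → g ≈A h
        one-to-one g h (_ , g𝟎≡𝟎) (_ , h𝟎≡𝟎) g≈h =
          trans (sym (act-𝟎 g)) (trans g𝟎≡𝟎 (trans (sym h𝟎≡𝟎) (act-𝟎 h))) , g≈h

    twoHomogeneous : MinDistAtLeast 5 C → C 𝟎 → TransitiveOn X (Cs C 2) →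
                     TwoHomogeneous (InducedOnM X)
    twoHomogeneous δ C𝟎 transitive i j k l i≢j k≢l
      with transitive (pair i j) (pair k l) (weight-in-Cs δ C𝟎 (pair i j) (dist-pair-𝟎 i j i≢j))
                                            (weight-in-Cs δ C𝟎 (pair k l) (dist-pair-𝟎 k l k≢l))
    ... | g , Xg , g[ij]≡kl = perm g , (g , Xg , λ _ → refl) , permute-pair (perm g) i≢j (begin
      permute (perm g) (pair i j) ≡⟨ act≡permute g g𝟎≡𝟎 (pair i j) ⟨
      act g (pair i j)            ≡⟨ g[ij]≡kl ⟩
      pair k l                    ∎)
      where
      open ≡-Reasoning
      g𝟎≡𝟎 : act g 𝟎 ≡ 𝟎
      g𝟎≡𝟎 = fixes-𝟎 δ C𝟎 Xg (pair i j) (dist-pair-𝟎 i j i≢j)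
                     (trans (cong (λ w → dist w 𝟎) g[ij]≡kl) (dist-pair-𝟎 k l k≢l))

lemma4p2 : (m : ℕ) (C : V m → Set) (X : Aut m → Set) →
    IsSubgroup X →
    StabilisesCode X C →
    (∃ λ c → C c) →
    NeighbourTransitive2 X C →
    TranslationsIn X C →
    MinDistAtLeast 5 C →
    X0≅XM X × TwoHomogeneous (InducedOnM X) × IsSubmodule X C
lemma4p2 m C X subgroup stabilises nonempty (_ , _ , C₂-transitive) translations δ =
    X₀≅X^M stabilises translations subgroup C𝟎
  , twoHomogeneous stabilises δ C𝟎 C₂-transitive
  , isSubmodule stabilises translations nonempty
  where
  C𝟎 : C 𝟎
  C𝟎 = 𝟎∈C stabilises translations nonempty
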